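{- For propositional variables $p,q$: ${\bf ITL}^{\bf CD}\not\vdash (\circ p\to\circ q)\to\circ(p\to q)$ and ${\bf ITL}^{\bf CD}\not\vdash (\Diamond p\to\Box q)\to\Box(p\to q)$.
   Context: Fix a countably infinite set $\mathbb P$ of propositional variables. The language $\mathcal L$ is given by $\varphi ::= \bot \mid p \mid \varphi\wedge\varphi \mid \varphi\vee\varphi\mid \varphi\to\varphi\mid \circ\varphi\mid\Diamond\varphi\mid\Box\varphi$ with $p\in\mathbb P$; $\neg\varphi$ abbreviates $\varphi\to\bot$, $\varphi\leftrightarrow\psi$ abbreviates $(\varphi\to\psi)\wedge(\psi\to\varphi)$. ${\bf ITL}^{\bf CD}$ is the least set of $\mathcal L$-formulas containing all ($\mathcal L$-instances of) intuitionistic propositional tautologies and all instances of $\neg\circ\bot$; $\circ(\varphi\wedge\psi)\leftrightarrow(\circ\varphi\wedge\circ\psi)$; $\circ(\varphi\vee\psi)\leftrightarrow(\circ\varphi\vee\circ\psi)$; $\circ(\varphi\to\psi)\to(\circ\varphi\to\circ\psi)$; $\Box(\varphi\to\psi)\to(\Box\varphi\to\Box\psi)$; $\Box(\varphi\to\psi)\to(\Diamond\varphi\to\Diamond\psi)$; $\Diamond(\varphi\vee\psi)\to(\Diamond\varphi\vee\Diamond\psi)$; $\Box\varphi\to\varphi\wedge\circ\Box\varphi$; $\varphi\vee\circ\Diamond\varphi\to\Diamond\varphi$; $\Box(\varphi\vee\psi)\to\Box\varphi\vee\Diamond\psi$; and closed under: from $\varphi\to\circ\varphi$ infer $\varphi\to\Box\varphi$;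 from $\circ\varphi\to\varphi$ infer $\Diamond\varphi\to\varphi$; modus ponens; from $\varphi$ infer $\circ\varphi$. ${\bf ITL}^{\bf CD}\vdash\varphi$ means $\varphi\in{\bf ITL}^{\bf CD}$. -}

module Defs where

open import Data.Nat using (ℕ)

Var : Set
Var = ℕ

infixr 5 _⇒_
infixl 7 _∧_
infixl 6 _∨_
data Fm : Set where
  ⊥'  : Fm
  var : Var → Fm
  _∧_ : Fm → Fm → Fm
  _∨_ : Fm → Fm → Fm
  _⇒_ : Fm → Fm → Fm
  ∘_  : Fm → Fm
  ◇_  : Fm → Fm
  □_  : Fm → Fm

¬'_ : Fm → Fm
¬' φ = φ ⇒ ⊥'

_⇔_ : Fm → Fm → Fm
φ ⇔ ψ = (φ ⇒ ψ) ∧ (ψ ⇒ φ)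

data PFm : Set where
  ⊥ₚ  : PFm
  varₚ : Var → PFm
  _∧ₚ_ : PFm → PFm → PFm
  _∨ₚ_ : PFm → PFm → PFm
  _⇒ₚ_ : PFm → PFm → PFm

data IPC : PFm → Set where
  ax-K   : ∀ {a b} → IPC (a ⇒ₚ (b ⇒ₚ a))
  ax-S   : ∀ {a b c} → IPC ((a ⇒ₚ (b ⇒ₚ c)) ⇒ₚ ((a ⇒ₚ b) ⇒ₚ (a ⇒ₚ c)))
  ax-∧E₁ : ∀ {a b} → IPC ((a ∧ₚ b) ⇒ₚ a)
  ax-∧E₂ : ∀ {a b} → IPC ((a ∧ₚ b) ⇒ₚ b)
  ax-∧I  : ∀ {a b} → IPC (a ⇒ₚ (b ⇒ₚ (a ∧ₚ b)))
  ax-∨I₁ : ∀ {a b} → IPC (a ⇒ₚ (a ∨ₚ b))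
  ax-∨I₂ : ∀ {a b} → IPC (b ⇒ₚ (a ∨ₚ b))
  ax-∨E  : ∀ {a b c} → IPC ((a ⇒ₚ c) ⇒ₚ ((b ⇒ₚ c) ⇒ₚ ((a ∨ₚ b) ⇒ₚ c)))
  ax-⊥E  : ∀ {a} → IPC (⊥ₚ ⇒ₚ a)
  mp     : ∀ {a b} → IPC (a ⇒ₚ b) → IPC a → IPC b

inst : (Var → Fm) → PFm → Fm
inst σ ⊥ₚ = ⊥'
inst σ (varₚ x) = σ x
inst σ (a ∧ₚ b) = inst σ a ∧ inst σ b
inst σ (a ∨ₚ b) = inst σ a ∨ inst σ b
inst σ (a ⇒ₚ b) = inst σ a ⇒ inst σ b

data ITLCD : Fm → Set where
  taut     : ∀ {a} → IPC a → (σ : Var → Fm) → ITLCD (inst σ a)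
  ax-∘⊥    : ITLCD (¬' (∘ ⊥'))
  ax-∘∧    : ∀ {φ ψ} → ITLCD ((∘ (φ ∧ ψ)) ⇔ ((∘ φ) ∧ (∘ ψ)))
  ax-∘∨    : ∀ {φ ψ} → ITLCD ((∘ (φ ∨ ψ)) ⇔ ((∘ φ) ∨ (∘ ψ)))
  ax-∘⇒    : ∀ {φ ψ} → ITLCD ((∘ (φ ⇒ ψ)) ⇒ ((∘ φ) ⇒ (∘ ψ)))
  ax-□K    : ∀ {φ ψ} → ITLCD ((□ (φ ⇒ ψ)) ⇒ ((□ φ) ⇒ (□ ψ)))
  ax-□◇    : ∀ {φ ψ} → ITLCD ((□ (φ ⇒ ψ)) ⇒ ((◇ φ) ⇒ (◇ ψ)))
  ax-◇∨    : ∀ {φ ψ} → ITLCD ((◇ (φ ∨ ψ)) ⇒ ((◇ φ) ∨ (◇ ψ)))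
  ax-□fix  : ∀ {φ} → ITLCD ((□ φ) ⇒ (φ ∧ (∘ (□ φ))))
  ax-◇fix  : ∀ {φ} → ITLCD ((φ ∨ (∘ (◇ φ))) ⇒ (◇ φ))
  ax-CD    : ∀ {φ ψ} → ITLCD ((□ (φ ∨ ψ)) ⇒ ((□ φ) ∨ (◇ ψ)))
  ind-□    : ∀ {φ} → ITLCD (φ ⇒ (∘ φ)) → ITLCD (φ ⇒ (□ φ))
  ind-◇    : ∀ {φ} → ITLCD ((∘ φ) ⇒ φ) → ITLCD ((◇ φ) ⇒ φ)
  mp       : ∀ {φ ψ} → ITLCD (φ ⇒ ψ) → ITLCD φ → ITLCD ψ
  nec-∘    : ∀ {φ} → ITLCD φ → ITLCD (∘ φ)

module Submission where

-- Both formulas are refuted by soundness with respect to one finite model.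
--
-- The frame has worlds w, x, u, intuitionistic order generated by x ≤ u and
-- successor map  next w = x, next x = x, next u = u  (monotone, since x ≤ u
-- and next x ≤ next u).  Propositions are the six upsets of this poset;
-- ∧, ∨, ⇒ are the Kripke clauses, ∘ is the preimage under next, and since
-- next is idempotent the orbit of a world v is {v, next v}, so □ and ◇ are
-- "at v and at next v" resp. "at v or at next v".
--
-- The corollary follows by evaluating both formulas under the valuation
-- p ↦ {u}, q ↦ ∅: each fails at the world w.

open import Defs
open import Data.Nat using (ℕ; _≟_)
open import Data.Bool using (Bool; true; false; not; T) renaming (_∧_ to _&&_; _∨_ to _||_)
open import Data.Bool.ListAction using (all)
open import Data.List using (List; []; _∷_)
open import Data.List.Membership.Propositional using (_∈_)
open import Data.List.Relation.Unary.Any using (here; there)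
open import Data.List.Relation.Unary.All using () renaming (lookup to lookupAll)
open import Data.List.Relation.Unary.All.Properties using (all⁺)
open import Data.Product using (_×_; _,_)
open import Relation.Nullary using (¬_; yes; no; contradiction)
open import Relation.Binary.PropositionalEquality
  using (_≡_; _≢_; refl; sym; trans; cong; cong₂; subst₂)

data World : Set where
  w x u : World

next : World → World
next w = x
next x = x
next u = u

above : World → List World
above w = w ∷ []
above x = x ∷ u ∷ []
above u = u ∷ []

data Upset : Set where
  ∅ W U WU XU WXU : Upset

holds : Upset → World → Bool
holds ∅   _ = false
holds W   w = true
holds W   _ = false
holds U   u = true
holds U   _ = false
holds WU  x = false
holds WU  _ = true
holds XU  w = false
holds XU  _ = true
holds WXU _ = true

-- The upset with a given characteristic function; the operations below
-- only apply it to upward closed functions (a non-closed one, true at x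
-- but not at u, is sent to its upward closure).
upset : (World → Bool) → Upset
upset f with f w | f x | f u
... | false | false | false = ∅
... | true  | false | false = W
... | false | false | true  = U
... | true  | false | true  = WU
... | false | true  | _     = XU
... | true  | true  | _     = WXU

_⊃_ : Bool → Bool → Bool
a ⊃ b = not a || b

infix  5 _⇔ᵘ_
infixr 6 _⇒ᵘ_
infixl 7 _∨ᵘ_
infixl 8 _∧ᵘ_
_∧ᵘ_ _∨ᵘ_ _⇒ᵘ_ _⇔ᵘ_ : Upset → Upset → Upset
a ∧ᵘ b = upset λ v → holds a v && holds b v
a ∨ᵘ b = upset λ v → holds a v || holds b v
a ⇒ᵘ b = upset λ v → all (λ v′ → holds a v′ ⊃ holds b v′) (above v)
a ⇔ᵘ b = (a ⇒ᵘ b) ∧ᵘ (b ⇒ᵘ a)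

∘ᵘ □ᵘ ◇ᵘ : Upset → Upset
∘ᵘ a = upset λ v → holds a (next v)
□ᵘ a = upset λ v → holds a v && holds a (next v)
◇ᵘ a = upset λ v → holds a v || holds a (next v)

isWXU : Upset → Bool
isWXU WXU = true
isWXU ∅   = false
isWXU W   = false
isWXU U   = false
isWXU WU  = false
isWXU XU  = false

isWXU-sound : ∀ a → T (isWXU a) → a ≡ WXU
isWXU-sound WXU _ = refl
isWXU-sound ∅   ()
isWXU-sound W   ()
isWXU-sound U   ()
isWXU-sound WU  ()
isWXU-sound XU  ()

universe : List Upset
universe = ∅ ∷ W ∷ U ∷ WU ∷ XU ∷ WXU ∷ []

∈-universe : ∀ a → a ∈ universe
∈-universe ∅   = here refl
∈-universe W   = there (here refl)
∈-universe U   = there (there (here refl))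
∈-universe WU  = there (there (there (here refl)))
∈-universe XU  = there (there (there (there (here refl))))
∈-universe WXU = there (there (there (there (there (here refl)))))

everywhere : (f : Upset → Bool) → T (all f universe) → ∀ a → T (f a)
everywhere f ok a = lookupAll (all⁺ f universe ok) (∈-universe a)

-- Identities in one, two and three upset variables; the boolean premise
-- is closed and is discharged by evaluation.
valid₁ : (f : Upset → Upset) → T (all (λ a → isWXU (f a)) universe) → ∀ a → f a ≡ WXU
valid₁ f ok a = isWXU-sound (f a) (everywhere (λ a → isWXU (f a)) ok a)

valid₂ : (f : Upset → Upset → Upset) →
  T (all (λ a → all (λ b → isWXU (f a b)) universe) universe) → ∀ a b → f a b ≡ WXU
valid₂ f ok a = valid₁ (f a) (everywhere (λ a → all (λ b → isWXU (f a b)) universe) ok a)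

valid₃ : (f : Upset → Upset → Upset → Upset) →
  T (all (λ a → all (λ b → all (λ c → isWXU (f a b c)) universe) universe) universe) →
  ∀ a b c → f a b c ≡ WXU
valid₃ f ok a =
  valid₂ (f a) (everywhere (λ a → all (λ b → all (λ c → isWXU (f a b c)) universe) universe) ok a)

Valuation : Set
Valuation = Var → Upset

evalₚ : Valuation → PFm → Upset
evalₚ ρ ⊥ₚ       = ∅
evalₚ ρ (varₚ i) = ρ i
evalₚ ρ (a ∧ₚ b) = evalₚ ρ a ∧ᵘ evalₚ ρ b
evalₚ ρ (a ∨ₚ b) = evalₚ ρ a ∨ᵘ evalₚ ρ b
evalₚ ρ (a ⇒ₚ b) = evalₚ ρ a ⇒ᵘ evalₚ ρ b

eval : Valuation → Fm → Upset
eval ρ ⊥'      = ∅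
eval ρ (var i) = ρ i
eval ρ (φ ∧ ψ) = eval ρ φ ∧ᵘ eval ρ ψ
eval ρ (φ ∨ ψ) = eval ρ φ ∨ᵘ eval ρ ψ
eval ρ (φ ⇒ ψ) = eval ρ φ ⇒ᵘ eval ρ ψ
eval ρ (∘ φ)   = ∘ᵘ (eval ρ φ)
eval ρ (◇ φ)   = ◇ᵘ (eval ρ φ)
eval ρ (□ φ)   = □ᵘ (eval ρ φ)

eval-inst : ∀ ρ σ a → eval ρ (inst σ a) ≡ evalₚ (λ i → eval ρ (σ i)) a
eval-inst ρ σ ⊥ₚ       = refl
eval-inst ρ σ (varₚ i) = refl
eval-inst ρ σ (a ∧ₚ b) = cong₂ _∧ᵘ_ (eval-inst ρ σ a) (eval-inst ρ σ b)
eval-inst ρ σ (a ∨ₚ b) = cong₂ _∨ᵘ_ (eval-inst ρ σ a) (eval-inst ρ σ b)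
eval-inst ρ σ (a ⇒ₚ b) = cong₂ _⇒ᵘ_ (eval-inst ρ σ a) (eval-inst ρ σ b)

WXU-⇒ : ∀ b → WXU ⇒ᵘ b ≡ b
WXU-⇒ ∅   = refl
WXU-⇒ W   = refl
WXU-⇒ U   = refl
WXU-⇒ WU  = refl
WXU-⇒ XU  = refl
WXU-⇒ WXU = refl

modus-ponens : ∀ a b → a ⇒ᵘ b ≡ WXU → a ≡ WXU → b ≡ WXU
modus-ponens a b imp refl = trans (sym (WXU-⇒ b)) imp

□-induction : ∀ a → a ⇒ᵘ ∘ᵘ a ≡ WXU → a ⇒ᵘ □ᵘ a ≡ WXU
□-induction ∅   _ = refl
□-induction W   ()
□-induction U   _ = refl
□-induction WU  ()
□-induction XU  _ = refl
□-induction WXU _ = refl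

◇-induction : ∀ a → ∘ᵘ a ⇒ᵘ a ≡ WXU → ◇ᵘ a ⇒ᵘ a ≡ WXU
◇-induction ∅   _ = refl
◇-induction W   _ = refl
◇-induction U   _ = refl
◇-induction WU  _ = refl
◇-induction XU  ()
◇-induction WXU _ = refl

ipc-sound : ∀ {a} → IPC a → ∀ ρ → evalₚ ρ a ≡ WXU
ipc-sound (ax-K {a} {b}) ρ =
  valid₂ (λ a b → a ⇒ᵘ b ⇒ᵘ a) _ (evalₚ ρ a) (evalₚ ρ b)
ipc-sound (ax-S {a} {b} {c}) ρ =
  valid₃ (λ a b c → (a ⇒ᵘ b ⇒ᵘ c) ⇒ᵘ (a ⇒ᵘ b) ⇒ᵘ a ⇒ᵘ c) _ (evalₚ ρ a) (evalₚ ρ b) (evalₚ ρ c)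
ipc-sound (ax-∧E₁ {a} {b}) ρ =
  valid₂ (λ a b → a ∧ᵘ b ⇒ᵘ a) _ (evalₚ ρ a) (evalₚ ρ b)
ipc-sound (ax-∧E₂ {a} {b}) ρ =
  valid₂ (λ a b → a ∧ᵘ b ⇒ᵘ b) _ (evalₚ ρ a) (evalₚ ρ b)
ipc-sound (ax-∧I {a} {b}) ρ =
  valid₂ (λ a b → a ⇒ᵘ b ⇒ᵘ a ∧ᵘ b) _ (evalₚ ρ a) (evalₚ ρ b)
ipc-sound (ax-∨I₁ {a} {b}) ρ =
  valid₂ (λ a b → a ⇒ᵘ a ∨ᵘ b) _ (evalₚ ρ a) (evalₚ ρ b)
ipc-sound (ax-∨I₂ {a} {b}) ρ =
  valid₂ (λ a b → b ⇒ᵘ a ∨ᵘ b) _ (evalₚ ρ a) (evalₚ ρ b)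
ipc-sound (ax-∨E {a} {b} {c}) ρ =
  valid₃ (λ a b c → (a ⇒ᵘ c) ⇒ᵘ (b ⇒ᵘ c) ⇒ᵘ a ∨ᵘ b ⇒ᵘ c) _ (evalₚ ρ a) (evalₚ ρ b) (evalₚ ρ c)
ipc-sound (ax-⊥E {a}) ρ =
  valid₁ (λ a → ∅ ⇒ᵘ a) _ (evalₚ ρ a)
ipc-sound (mp {a} {b} d e) ρ =
  modus-ponens (evalₚ ρ a) (evalₚ ρ b) (ipc-sound d ρ) (ipc-sound e ρ)

sound : ∀ {φ} → ITLCD φ → ∀ ρ → eval ρ φ ≡ WXU
sound (taut {a} d σ) ρ = trans (eval-inst ρ σ a) (ipc-sound d _)
sound ax-∘⊥ ρ = refl
sound (ax-∘∧ {φ} {ψ}) ρ =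
  valid₂ (λ a b → ∘ᵘ (a ∧ᵘ b) ⇔ᵘ ∘ᵘ a ∧ᵘ ∘ᵘ b) _ (eval ρ φ) (eval ρ ψ)
sound (ax-∘∨ {φ} {ψ}) ρ =
  valid₂ (λ a b → ∘ᵘ (a ∨ᵘ b) ⇔ᵘ ∘ᵘ a ∨ᵘ ∘ᵘ b) _ (eval ρ φ) (eval ρ ψ)
sound (ax-∘⇒ {φ} {ψ}) ρ =
  valid₂ (λ a b → ∘ᵘ (a ⇒ᵘ b) ⇒ᵘ ∘ᵘ a ⇒ᵘ ∘ᵘ b) _ (eval ρ φ) (eval ρ ψ)
sound (ax-□K {φ} {ψ}) ρ =
  valid₂ (λ a b → □ᵘ (a ⇒ᵘ b) ⇒ᵘ □ᵘ a ⇒ᵘ □ᵘ b) _ (eval ρ φ) (eval ρ ψ)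
sound (ax-□◇ {φ} {ψ}) ρ =
  valid₂ (λ a b → □ᵘ (a ⇒ᵘ b) ⇒ᵘ ◇ᵘ a ⇒ᵘ ◇ᵘ b) _ (eval ρ φ) (eval ρ ψ)
sound (ax-◇∨ {φ} {ψ}) ρ =
  valid₂ (λ a b → ◇ᵘ (a ∨ᵘ b) ⇒ᵘ ◇ᵘ a ∨ᵘ ◇ᵘ b) _ (eval ρ φ) (eval ρ ψ)
sound (ax-□fix {φ}) ρ =
  valid₁ (λ a → □ᵘ a ⇒ᵘ a ∧ᵘ ∘ᵘ (□ᵘ a)) _ (eval ρ φ)
sound (ax-◇fix {φ}) ρ =
  valid₁ (λ a → a ∨ᵘ ∘ᵘ (◇ᵘ a) ⇒ᵘ ◇ᵘ a) _ (eval ρ φ)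
sound (ax-CD {φ} {ψ}) ρ =
  valid₂ (λ a b → □ᵘ (a ∨ᵘ b) ⇒ᵘ □ᵘ a ∨ᵘ ◇ᵘ b) _ (eval ρ φ) (eval ρ ψ)
sound (ind-□ {φ} d) ρ = □-induction (eval ρ φ) (sound d ρ)
sound (ind-◇ {φ} d) ρ = ◇-induction (eval ρ φ) (sound d ρ)
sound (mp {φ} {ψ} d e) ρ = modus-ponens (eval ρ φ) (eval ρ ψ) (sound d ρ) (sound e ρ)
sound (nec-∘ d) ρ = cong ∘ᵘ (sound d ρ)

refuted-by : ∀ ρ φ → eval ρ φ ≢ WXU → ¬ ITLCD φ
refuted-by ρ φ fails d = fails (sound d ρ)

only : Var → Upset → Valuation
only p a i with i ≟ p
... | yes _ = a
... | no  _ = ∅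

only-at : ∀ p a → only p a p ≡ a
only-at p a with p ≟ p
... | yes _   = refl
... | no  p≢p = contradiction refl p≢p

only-elsewhere : ∀ {p q} a → p ≢ q → only p a q ≡ ∅
only-elsewhere {p} {q} a p≢q with q ≟ p
... | yes q≡p = contradiction (sym q≡p) p≢q
... | no  _   = refl

corollary6p4 : (p q : ℕ) → p ≢ q →
    ¬ ITLCD (((∘ var p) ⇒ (∘ var q)) ⇒ (∘ (var p ⇒ var q)))
    × ¬ ITLCD (((◇ var p) ⇒ (□ var q)) ⇒ (□ (var p ⇒ var q)))
corollary6p4 p q p≢q =
    refuted-by ρ _ (fails-at-U∅ (λ a b → (∘ᵘ a ⇒ᵘ ∘ᵘ b) ⇒ᵘ ∘ᵘ (a ⇒ᵘ b)) λ ())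
  , refuted-by ρ _ (fails-at-U∅ (λ a b → (◇ᵘ a ⇒ᵘ □ᵘ b) ⇒ᵘ □ᵘ (a ⇒ᵘ b)) λ ())
  where
  ρ : Valuation
  ρ = only p U

  -- Both formulas evaluate as a binary operation F applied to (ρ p, ρ q);
  -- it suffices that F U ∅ (which is XU in both cases) is not full.
  fails-at-U∅ : (F : Upset → Upset → Upset) → F U ∅ ≢ WXU → F (ρ p) (ρ q) ≢ WXU
  fails-at-U∅ F =
    subst₂ (λ a b → F a b ≢ WXU) (sym (only-at p U)) (sym (only-elsewhere U p≢q))
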